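{- For every positive integer $k$ one can construct a $k$-uniform hypergraph that is not 2-colorable and has at most $(2^{1 + o(1)})^{k}$ edges, where $o(1)$ denotes a quantity tending to $0$ as $k \to \infty$.
   Context: A hypergraph is $k$-uniform if every edge is a set of exactly $k$ vertices. A hypergraph is 2-colorable if there is a red/blue coloring of its vertices such that no edge is monochromatic; "not 2-colorable" means every red/blue coloring of the vertices makes some edge monochromatic. -}

module Defs where

open import Data.Nat using (ℕ)
open import Data.Bool using (Bool)
open import Data.Fin using (Fin)
open import Data.Fin.Subset using (Subset; _∈_; ∣_∣)
open import Data.List using (List; length)
open import Data.List.Relation.Unary.All using (All)
open import Data.Product using (Σ; ∃; _×_)
open import Relation.Nullary using (¬_)
open import Relation.Binary.PropositionalEquality using (_≡_)

record Hypergraph : Set where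
  constructor mkHypergraph
  field
    nVertices : ℕ
    edges     : List (Subset nVertices)

open Hypergraph public

numEdges : Hypergraph → ℕ
numEdges H = length (edges H)

Uniform : ℕ → Hypergraph → Set
Uniform k H = All (λ e → ∣ e ∣ ≡ k) (edges H)

Coloring : Hypergraph → Set
Coloring H = Fin (nVertices H) → Bool

Monochromatic : (H : Hypergraph) → Coloring H → Subset (nVertices H) → Set
Monochromatic H c e = ∃ λ (b : Bool) → ∀ v → v ∈ e → c v ≡ b

TwoColorable : Hypergraph → Set
TwoColorable H = Σ (Coloring H) λ c → All (λ e → ¬ Monochromatic H c e) (edges H)

-- A derandomisation of Erdős's random construction. On 2h vertices, h = k(2k+1), every colouring
-- has a colour class of at least h vertices, so at least C(h,k) ≥ C(2h,k)/2^(k+1) of the k-subsets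
-- are monochromatic under it. By double counting, for any set of colourings some k-subset is
-- monochromatic under at least a 2^-(k+1) fraction of them. Adding such a k-subset as an edge
-- 2^(k+1)(2h+1) times, each time discarding the colourings it rules out, leaves at most
-- 2^(2h) (1 - 2^-(k+1))^(2^(k+1)(2h+1)) ≤ 2^(2h) 2^-(2h+1) < 1 proper colourings. The resulting
-- 2^(k+1)(4k²+2k+1) edges are 2^((1+o(1))k).

module Submission where

open import Data.Bool using (Bool; true; false; not; _∨_; if_then_else_; T; T?)
open import Data.Bool.Properties using (∨-zeroʳ; not-injective)
open import Data.Fin using (Fin)
open import Data.Fin.Properties using (¬Fin0)
open import Data.Fin.Subset using (Subset; inside; outside; ∁; ∣_∣) renaming (⊥ to ∅)
open import Data.Fin.Subset.Properties using (_⊆?_; ∣⊥∣≡0; ∣∁p∣≡n∸∣p∣)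
open import Data.List using (List; []; _∷_; _++_; map; length; filterᵇ)
open import Data.List.Extrema.Nat using (argmax; argmax-sel; f[xs]≤f[argmax])
open import Data.List.Membership.Propositional using (_∈_)
open import Data.List.Membership.Propositional.Properties using (∈-map⁺; ∈-++⁺ˡ; ∈-++⁺ʳ; ∈-filter⁺)
open import Data.List.Properties using (map-++; map-∘; length-++; length-map)
open import Data.List.Relation.Unary.All as All using (All; []; _∷_)
open import Data.List.Relation.Unary.All.Properties
  using (All¬⇒¬Any) renaming (map⁺ to All-map⁺; ++⁺ to All-++⁺)
open import Data.List.Relation.Unary.Any as Any using (Any; here; there; index)
open import Data.Nat
  using (ℕ; zero; suc; pred; _+_; _*_; _^_; _∸_; _!; _≤_; _>_; _≤ᵇ_; z≤n; s≤s; _≤′_; ≤′-refl; ≤′-step;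
         NonZero; >-nonZero)
open import Data.Nat.Combinatorics using (_C_; nCk≡nPk/k!; nCk+nC[k+1]≡[n+1]C[k+1])
open import Data.Nat.Combinatorics.Base using (_P_; _P′_)
open import Data.Nat.Combinatorics.Specification using (k!∣nP′k)
open import Data.Nat.DivMod using (_/_; m*[n/m]≡n)
open import Data.Nat.ListAction using (sum)
open import Data.Nat.ListAction.Properties using (sum-++)
open import Data.Nat.Properties
open import Algebra.Properties.CommutativeSemigroup *-commutativeSemigroup
  using (xy∙z≈xz∙y; xy∙z≈y∙xz; x∙yz≈xz∙y; x∙yz≈y∙xz)
open import Data.Nat.Tactic.RingSolver using (solve-∀)
open import Data.Product using (∃; _×_; _,_; proj₁; proj₂)
open import Data.Sum using (_⊎_; inj₁; inj₂; [_,_]′)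
open import Data.Unit using (tt)
open import Data.Vec using ([]; _∷_; lookup; tabulate)
open import Data.Vec.Properties using ([]=⇒lookup; lookup∘tabulate; lookup-map)
open import Function using (_∘_)
open import Relation.Binary.PropositionalEquality
  using (_≡_; refl; sym; trans; cong; cong₂; subst; module ≡-Reasoning)
open import Relation.Nullary using (¬_; yes; no; does)

open import Defs

^-distribʳ-* : ∀ m n p → (m * n) ^ p ≡ m ^ p * n ^ p
^-distribʳ-* m n zero = refl
^-distribʳ-* m n (suc p) = begin
  m * n * (m * n) ^ p      ≡⟨ cong (m * n *_) (^-distribʳ-* m n p) ⟩
  m * n * (m ^ p * n ^ p)  ≡⟨ [m*n]*[o*p]≡[m*o]*[n*p] m n (m ^ p) (n ^ p) ⟩
  m * m ^ p * (n * n ^ p)  ∎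
  where open ≡-Reasoning

x^j*[x+j]≤[1+x]^j*x : ∀ x j → x ^ j * (x + j) ≤ suc x ^ j * x
x^j*[x+j]≤[1+x]^j*x x zero = ≤-reflexive (cong (_+ 0) (+-identityʳ x))
x^j*[x+j]≤[1+x]^j*x x (suc j) = begin
  x * a * (x + suc j)              ≡⟨ split x a j ⟩
  x * (a * (x + j)) + a * x        ≤⟨ +-monoʳ-≤ (x * (a * (x + j))) (*-monoʳ-≤ a (m≤m+n x j)) ⟩
  x * (a * (x + j)) + a * (x + j)  ≡⟨ +-comm (x * (a * (x + j))) (a * (x + j)) ⟩
  suc x * (a * (x + j))            ≤⟨ *-monoʳ-≤ (suc x) (x^j*[x+j]≤[1+x]^j*x x j) ⟩
  suc x * (suc x ^ j * x)          ≡⟨ *-assoc (suc x) (suc x ^ j) x ⟨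
  suc x * suc x ^ j * x            ∎
  where
  open ≤-Reasoning
  a : ℕ
  a = x ^ j
  split : ∀ x a j → x * a * (x + suc j) ≡ x * (a * (x + j)) + a * x
  split = solve-∀

[1+x]^j*x≤x^j*[x+2j] : ∀ x j → 2 * j ≤ x → suc x ^ j * x ≤ x ^ j * (x + 2 * j)
[1+x]^j*x≤x^j*[x+2j] x zero _ = ≤-reflexive (cong (_+ 0) (sym (+-identityʳ x)))
[1+x]^j*x≤x^j*[x+2j] x (suc j) 2j+2≤x = begin
  suc x * suc x ^ j * x              ≡⟨ *-assoc (suc x) (suc x ^ j) x ⟩
  suc x * (suc x ^ j * x)            ≤⟨ *-monoʳ-≤ (suc x) ([1+x]^j*x≤x^j*[x+2j] x j 2j≤x) ⟩
  suc x * (a * (x + 2 * j))          ≡⟨ expand x a j ⟩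
  a * (x * (x + 2 * j) + x + 2 * j)  ≤⟨ *-monoʳ-≤ a (+-monoʳ-≤ (x * (x + 2 * j) + x) 2j≤x) ⟩
  a * (x * (x + 2 * j) + x + x)      ≡⟨ collect x a j ⟩
  x * a * (x + 2 * suc j)            ∎
  where
  open ≤-Reasoning
  a : ℕ
  a = x ^ j
  2j≤x : 2 * j ≤ x
  2j≤x = ≤-trans (*-monoʳ-≤ 2 (n≤1+n j)) 2j+2≤x
  expand : ∀ x a j → suc x * (a * (x + 2 * j)) ≡ a * (x * (x + 2 * j) + x + 2 * j)
  expand = solve-∀
  collect : ∀ x a j → a * (x * (x + 2 * j) + x + x) ≡ x * a * (x + 2 * suc j)
  collect = solve-∀

[1+x]^j≤2*x^j : ∀ x j → 2 * j ≤ x → suc x ^ j ≤ 2 * x ^ j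
[1+x]^j≤2*x^j zero zero _ = s≤s z≤n
[1+x]^j≤2*x^j x@(suc _) j 2j≤x = *-cancelʳ-≤ (suc x ^ j) (2 * x ^ j) x (begin
  suc x ^ j * x        ≤⟨ [1+x]^j*x≤x^j*[x+2j] x j 2j≤x ⟩
  x ^ j * (x + 2 * j)  ≤⟨ *-monoʳ-≤ (x ^ j) (+-monoʳ-≤ x 2j≤x) ⟩
  x ^ j * (x + x)      ≡⟨ double x (x ^ j) ⟩
  2 * x ^ j * x        ∎)
  where
  open ≤-Reasoning
  double : ∀ x a → a * (x + x) ≡ 2 * a * x
  double = solve-∀

2*x^[1+x]≤[1+x]^[1+x] : ∀ x → 2 * x ^ suc x ≤ suc x ^ suc x
2*x^[1+x]≤[1+x]^[1+x] x = begin
  2 * (x * x ^ x)   ≡⟨ double x (x ^ x) ⟩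
  x ^ x * (x + x)   ≤⟨ x^j*[x+j]≤[1+x]^j*x x x ⟩
  suc x ^ x * x     ≤⟨ *-monoʳ-≤ (suc x ^ x) (n≤1+n x) ⟩
  suc x ^ x * suc x ≡⟨ *-comm (suc x ^ x) (suc x) ⟩
  suc x ^ suc x     ∎
  where
  open ≤-Reasoning
  double : ∀ x a → 2 * (x * a) ≡ a * (x + x)
  double = solve-∀

2*n≤2^n : ∀ n → 2 * n ≤ 2 ^ n
2*n≤2^n zero = z≤n
2*n≤2^n (suc zero) = ≤-refl
2*n≤2^n (suc (suc n)) = begin
  2 * suc (suc n)       ≡⟨ *-suc 2 (suc n) ⟩
  2 + 2 * suc n         ≤⟨ +-mono-≤ (*-monoʳ-≤ 2 (m^n>0 2 n)) (2*n≤2^n (suc n)) ⟩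
  2 ^ suc n + 2 ^ suc n ≡⟨ cong (2 ^ suc n +_) (+-identityʳ (2 ^ suc n)) ⟨
  2 * 2 ^ suc n         ∎
  where open ≤-Reasoning

k^p≤2^k : ∀ p k → 4 ^ p ≤ k → k ^ p ≤ 2 ^ k
k^p≤2^k p k 4^p≤k = go (≤⇒≤′ 4^p≤k)
  where
  open ≤-Reasoning
  2p≤4^p : 2 * p ≤ 4 ^ p
  2p≤4^p = ≤-trans (2*n≤2^n p) (^-monoˡ-≤ p (s≤s (s≤s z≤n)))
  2p²≤4^p : 2 * (p * p) ≤ 4 ^ p
  2p²≤4^p = begin
    2 * (p * p)    ≡⟨ *-assoc 2 p p ⟨
    2 * p * p      ≤⟨ *-mono-≤ (2*n≤2^n p) (≤-trans (m≤m+n p (p + 0)) (2*n≤2^n p)) ⟩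
    2 ^ p * 2 ^ p  ≡⟨ ^-distribʳ-* 2 2 p ⟨
    4 ^ p          ∎
  go : ∀ {k} → 4 ^ p ≤′ k → k ^ p ≤ 2 ^ k
  go ≤′-refl = begin
    (4 ^ p) ^ p        ≡⟨ ^-*-assoc 4 p p ⟩
    (2 ^ 2) ^ (p * p)  ≡⟨ ^-*-assoc 2 2 (p * p) ⟩
    2 ^ (2 * (p * p))  ≤⟨ ^-monoʳ-≤ 2 2p²≤4^p ⟩
    2 ^ (4 ^ p)        ∎
  go {suc k} (≤′-step 4^p≤′k) = begin
    suc k ^ p   ≤⟨ [1+x]^j≤2*x^j k p (≤-trans 2p≤4^p (≤′⇒≤ 4^p≤′k)) ⟩
    2 * k ^ p   ≤⟨ *-monoʳ-≤ 2 (go 4^p≤′k) ⟩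
    2 ^ suc k   ∎

-- Binomial coefficients

nPk≡nP′k : ∀ {n k} → k ≤ n → n P k ≡ n P′ k
nPk≡nP′k {n} {k} k≤n with k ≤ᵇ n | ≤⇒≤ᵇ k≤n
... | true | _ = refl

k!*nCk≡nP′k : ∀ {n k} → k ≤ n → k ! * (n C k) ≡ n P′ k
k!*nCk≡nP′k {n} {k} k≤n = begin
  k ! * (n C k)           ≡⟨ cong (k ! *_) (nCk≡nPk/k! k≤n) ⟩
  k ! * ((n P k) / k !)   ≡⟨ cong (λ m → k ! * (m / k !)) (nPk≡nP′k k≤n) ⟩
  k ! * ((n P′ k) / k !)  ≡⟨ m*[n/m]≡n (k!∣nP′k k≤n) ⟩
  n P′ k                  ∎
  where
  open ≡-Reasoning
  instance _ = k !≢0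

nP′k≤n^k : ∀ n k → n P′ k ≤ n ^ k
nP′k≤n^k n zero = ≤-refl
nP′k≤n^k n (suc k) = *-mono-≤ (m∸n≤m n k) (nP′k≤n^k n k)

[n∸k]^k≤nP′k : ∀ n k → (n ∸ k) ^ k ≤ n P′ k
[n∸k]^k≤nP′k n zero = ≤-refl
[n∸k]^k≤nP′k n (suc k) = *-mono-≤ n∸[1+k]≤n∸k
  (≤-trans (^-monoˡ-≤ k n∸[1+k]≤n∸k) ([n∸k]^k≤nP′k n k))
  where
  n∸[1+k]≤n∸k : n ∸ suc k ≤ n ∸ k
  n∸[1+k]≤n∸k = ∸-monoʳ-≤ n (n≤1+n k)

nCk>0 : ∀ {n k} → k ≤ n → n C k > 0
nCk>0 z≤n = s≤s z≤n
nCk>0 {suc n} {suc k} (s≤s k≤n) = begin-strict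
  0                  <⟨ nCk>0 k≤n ⟩
  n C k              ≤⟨ m≤m+n (n C k) (n C suc k) ⟩
  n C k + n C suc k  ≡⟨ nCk+nC[k+1]≡[n+1]C[k+1] n k ⟩
  suc n C suc k      ∎
  where open ≤-Reasoning

nCk≤[1+n]Ck : ∀ n k → n C k ≤ suc n C k
nCk≤[1+n]Ck n zero = ≤-refl
nCk≤[1+n]Ck n (suc k) = ≤-trans (m≤n+m (n C suc k) (n C k)) (≤-reflexive (nCk+nC[k+1]≡[n+1]C[k+1] n k))

m≤n⇒mCk≤nCk : ∀ {m n} k → m ≤ n → m C k ≤ n C k
m≤n⇒mCk≤nCk {m} k m≤n = go (≤⇒≤′ m≤n)
  where
  go : ∀ {n} → m ≤′ n → m C k ≤ n C k
  go ≤′-refl = ≤-refl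
  go {suc n} (≤′-step m≤′n) = ≤-trans (go m≤′n) (nCk≤[1+n]Ck n k)

-- Half the number of vertices; it is of order k² so that (1 + k/(h - k))^k ≤ 2 in the bound below.
halfOrder : ℕ → ℕ
halfOrder k = k * suc (2 * k)

k≤halfOrder : ∀ k → k ≤ halfOrder k
k≤halfOrder k = m≤m*n k (suc (2 * k))

[h+h]Ck≤2^[1+k]*hCk : ∀ k → let h = halfOrder k in (h + h) C k ≤ 2 ^ suc k * (h C k)
[h+h]Ck≤2^[1+k]*hCk k = *-cancelˡ-≤ (k !) (begin
  k ! * ((h + h) C k)          ≡⟨ k!*nCk≡nP′k (≤-trans k≤h (m≤m+n h h)) ⟩
  (h + h) P′ k                 ≤⟨ nP′k≤n^k (h + h) k ⟩
  (h + h) ^ k                  ≡⟨ cong (_^ k) (h+h≡x*[1+x] k) ⟩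
  (x * suc x) ^ k              ≡⟨ ^-distribʳ-* x (suc x) k ⟩
  x ^ k * suc x ^ k            ≤⟨ *-monoʳ-≤ (x ^ k) ([1+x]^j≤2*x^j x k ≤-refl) ⟩
  x ^ k * (2 * x ^ k)          ≡⟨ x∙yz≈y∙xz (x ^ k) 2 (x ^ k) ⟩
  2 * (x ^ k * x ^ k)          ≡⟨ cong (2 *_) (^-distribʳ-* x x k) ⟨
  2 * (x * x) ^ k              ≡⟨ cong (λ y → 2 * y ^ k) (*-assoc 2 k x) ⟩
  2 * (2 * (k * x)) ^ k        ≡⟨ cong (2 *_) (^-distribʳ-* 2 (k * x) k) ⟩
  2 * (2 ^ k * (k * x) ^ k)    ≡⟨ *-assoc 2 (2 ^ k) ((k * x) ^ k) ⟨
  2 ^ suc k * (k * x) ^ k      ≡⟨ cong (λ y → 2 ^ suc k * y ^ k) h∸k≡k*x ⟨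
  2 ^ suc k * (h ∸ k) ^ k      ≤⟨ *-monoʳ-≤ (2 ^ suc k) ([n∸k]^k≤nP′k h k) ⟩
  2 ^ suc k * (h P′ k)         ≡⟨ cong (2 ^ suc k *_) (k!*nCk≡nP′k k≤h) ⟨
  2 ^ suc k * (k ! * (h C k))  ≡⟨ x∙yz≈y∙xz (2 ^ suc k) (k !) (h C k) ⟩
  k ! * (2 ^ suc k * (h C k))  ∎)
  where
  open ≤-Reasoning
  instance _ = k !≢0
  x h : ℕ
  x = 2 * k
  h = halfOrder k
  k≤h : k ≤ h
  k≤h = k≤halfOrder k
  h∸k≡k*x : h ∸ k ≡ k * x
  h∸k≡k*x = trans (cong (_∸ k) (*-suc k x)) (m+n∸m≡n k (k * x))
  h+h≡x*[1+x] : ∀ k → k * suc (2 * k) + k * suc (2 * k) ≡ 2 * k * suc (2 * k)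
  h+h≡x*[1+x] = solve-∀

indicator : Bool → ℕ
indicator b = if b then 1 else 0

indicator-mono : ∀ b c → (b ≡ true → c ≡ true) → indicator b ≤ indicator c
indicator-mono false c _ = z≤n
indicator-mono true c b⇒c rewrite b⇒c refl = ≤-refl

count : {A : Set} → (A → Bool) → List A → ℕ
count p xs = sum (map (indicator ∘ p) xs)

module _ {A : Set} where

  sum-map-zero : (xs : List A) → sum (map (λ _ → 0) xs) ≡ 0
  sum-map-zero [] = refl
  sum-map-zero (x ∷ xs) = sum-map-zero xs

  sum-map-+ : ∀ (f g : A → ℕ) xs → sum (map (λ x → f x + g x) xs) ≡ sum (map f xs) + sum (map g xs)
  sum-map-+ f g [] = refl
  sum-map-+ f g (x ∷ xs) = trans (cong (f x + g x +_) (sum-map-+ f g xs))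
    ([m+n]+[o+p]≡[m+o]+[n+p] (f x) (g x) (sum (map f xs)) (sum (map g xs)))
    where
    [m+n]+[o+p]≡[m+o]+[n+p] : ∀ m n o p → m + n + (o + p) ≡ m + o + (n + p)
    [m+n]+[o+p]≡[m+o]+[n+p] = solve-∀

  length*≤sum-map : ∀ {a} (f : A → ℕ) xs → (∀ x → a ≤ f x) → length xs * a ≤ sum (map f xs)
  length*≤sum-map f [] a≤f = z≤n
  length*≤sum-map f (x ∷ xs) a≤f = +-mono-≤ (a≤f x) (length*≤sum-map f xs a≤f)

  sum-map≤length* : ∀ {b} (f : A → ℕ) {xs} → All (λ x → f x ≤ b) xs → sum (map f xs) ≤ length xs * b
  sum-map≤length* f [] = z≤n
  sum-map≤length* f (fx≤b ∷ fxs≤b) = +-mono-≤ fx≤b (sum-map≤length* f fxs≤b)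

  count-++ : ∀ (p : A → Bool) xs ys → count p (xs ++ ys) ≡ count p xs + count p ys
  count-++ p xs ys = trans (cong sum (map-++ (indicator ∘ p) xs ys)) (sum-++ (map (indicator ∘ p) xs) _)

  count-map : ∀ {B : Set} (p : B → Bool) (f : A → B) xs → count p (map f xs) ≡ count (p ∘ f) xs
  count-map p f xs = cong sum (sym (map-∘ xs))

  length-++-map : ∀ {B : Set} (f g : A → B) xs ys → length (map f xs ++ map g ys) ≡ length xs + length ys
  length-++-map f g xs ys = trans (length-++ (map f xs)) (cong₂ _+_ (length-map f xs) (length-map g ys))

  count-mono : ∀ {p q : A → Bool} → (∀ x → p x ≡ true → q x ≡ true) → ∀ xs → count p xs ≤ count q xs
  count-mono p⇒q [] = z≤n
  count-mono {p} {q} p⇒q (x ∷ xs) = +-mono-≤ (indicator-mono (p x) (q x) (p⇒q x)) (count-mono p⇒q xs)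

  count+length-filterᵇ-not : ∀ (p : A → Bool) xs → count p xs + length (filterᵇ (not ∘ p) xs) ≡ length xs
  count+length-filterᵇ-not p [] = refl
  count+length-filterᵇ-not p (x ∷ xs) with p x
  ... | true = cong suc (count+length-filterᵇ-not p xs)
  ... | false = trans (+-suc (count p xs) _) (cong suc (count+length-filterᵇ-not p xs))

count-++-map : ∀ {A B : Set} (p : B → Bool) (f g : A → B) xs ys →
               count p (map f xs ++ map g ys) ≡ count (p ∘ f) xs + count (p ∘ g) ys
count-++-map p f g xs ys = trans (count-++ p (map f xs) (map g ys)) (cong₂ _+_ (count-map p f xs) (count-map p g ys))

sum-map-swap : ∀ {A B : Set} (f : A → B → ℕ) as bs →
  sum (map (λ a → sum (map (f a) bs)) as) ≡ sum (map (λ b → sum (map (λ a → f a b) as)) bs)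
sum-map-swap f [] bs = sym (sum-map-zero bs)
sum-map-swap f (a ∷ as) bs = trans (cong (sum (map (f a) bs) +_) (sum-map-swap f as bs))
  (sym (sum-map-+ (f a) (λ b → sum (map (λ a → f a b) as)) bs))

-- Greedy covering

module Greedy {E C : Set} (hits : E → C → Bool) (candidates : List E) (e₀ : E) where

  survivors : E → List C → List C
  survivors S = filterᵇ (not ∘ hits S)

  bestCandidate : List C → E
  bestCandidate R = argmax (λ S → count (hits S) R) e₀ candidates

  greedyEdges : ℕ → List C → List E
  greedyEdges zero R = []
  greedyEdges (suc j) R = bestCandidate R ∷ greedyEdges j (survivors (bestCandidate R) R)

  uncovered : ℕ → List C → List C
  uncovered zero R = R
  uncovered (suc j) R = uncovered j (survivors (bestCandidate R) R)

  length-greedyEdges : ∀ j R → length (greedyEdges j R) ≡ j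
  length-greedyEdges zero R = refl
  length-greedyEdges (suc j) R = cong suc (length-greedyEdges j _)

  greedyEdges⊆candidates : ∀ j R → All (_∈ e₀ ∷ candidates) (greedyEdges j R)
  greedyEdges⊆candidates zero R = []
  greedyEdges⊆candidates (suc j) R =
    [ here , there ]′ (argmax-sel (λ S → count (hits S) R) e₀ candidates) ∷ greedyEdges⊆candidates j _

  hit-or-survives : ∀ S {R c} → c ∈ R → hits S c ≡ true ⊎ c ∈ survivors S R
  hit-or-survives S {c = c} c∈R with hits S c in eq
  ... | true = inj₁ refl
  ... | false = inj₂ (∈-filter⁺ (T? ∘ not ∘ hits S) c∈R (subst (T ∘ not) (sym eq) tt))

  greedyEdges-cover : ∀ j R {c} → c ∈ R →
                      Any (λ S → hits S c ≡ true) (greedyEdges j R) ⊎ c ∈ uncovered j R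
  greedyEdges-cover zero R c∈R = inj₂ c∈R
  greedyEdges-cover (suc j) R c∈R with hit-or-survives (bestCandidate R) c∈R
  ... | inj₁ hit = inj₁ (here hit)
  ... | inj₂ c∈R′ with greedyEdges-cover j _ c∈R′
  ...   | inj₁ hit = inj₁ (there hit)
  ...   | inj₂ c∈uncovered = inj₂ c∈uncovered

  module _ (d A : ℕ) .{{_ : NonZero A}}
           (hitOften : ∀ c → A ≤ count (λ S → hits S c) candidates)
           (fewCandidates : length candidates ≤ suc d * A) where

    -- Double counting of the pairs (S, c) with S hitting c.
    length≤[1+d]*bestScore : ∀ R → length R ≤ suc d * count (hits (bestCandidate R)) R
    length≤[1+d]*bestScore R = *-cancelʳ-≤ (length R) (suc d * best) A (begin
      length R * A
        ≤⟨ length*≤sum-map _ R hitOften ⟩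
      sum (map (λ c → count (λ S → hits S c) candidates) R)
        ≡⟨ sum-map-swap (λ c S → indicator (hits S c)) R candidates ⟩
      sum (map (λ S → count (hits S) R) candidates)
        ≤⟨ sum-map≤length* _ (f[xs]≤f[argmax] e₀ candidates) ⟩
      length candidates * best
        ≤⟨ *-monoˡ-≤ best fewCandidates ⟩
      suc d * A * best
        ≡⟨ xy∙z≈xz∙y (suc d) A best ⟩
      suc d * best * A
        ∎)
      where
      open ≤-Reasoning
      best : ℕ
      best = count (hits (bestCandidate R)) R

    length-survivors : ∀ R → length (survivors (bestCandidate R) R) * suc d ≤ length R * d
    length-survivors R = begin
      s′ * suc d          ≡⟨ *-suc s′ d ⟩
      s′ + s′ * d         ≤⟨ +-monoˡ-≤ (s′ * d) s′≤hit*d ⟩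
      hit * d + s′ * d    ≡⟨ *-distribʳ-+ d hit s′ ⟨
      (hit + s′) * d      ≡⟨ cong (_* d) (count+length-filterᵇ-not (hits S) R) ⟩
      length R * d        ∎
      where
      open ≤-Reasoning
      S : E
      S = bestCandidate R
      hit s′ : ℕ
      hit = count (hits S) R
      s′ = length (survivors S R)
      s′≤hit*d : s′ ≤ hit * d
      s′≤hit*d = +-cancelˡ-≤ hit s′ (hit * d) (begin
        hit + s′       ≡⟨ count+length-filterᵇ-not (hits S) R ⟩
        length R       ≤⟨ length≤[1+d]*bestScore R ⟩
        suc d * hit    ≡⟨ *-comm (suc d) hit ⟩
        hit * suc d    ≡⟨ *-suc hit d ⟩
        hit + hit * d  ∎)

    length-uncovered : ∀ j R → length (uncovered j R) * suc d ^ j ≤ length R * d ^ j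
    length-uncovered zero R = ≤-refl
    length-uncovered (suc j) R = begin
      u * (suc d * suc d ^ j)       ≡⟨ x∙yz≈xz∙y u (suc d) (suc d ^ j) ⟩
      u * suc d ^ j * suc d         ≤⟨ *-monoˡ-≤ (suc d) (length-uncovered j R′) ⟩
      length R′ * d ^ j * suc d     ≡⟨ xy∙z≈xz∙y (length R′) (d ^ j) (suc d) ⟩
      length R′ * suc d * d ^ j     ≤⟨ *-monoˡ-≤ (d ^ j) (length-survivors R) ⟩
      length R * d * d ^ j          ≡⟨ *-assoc (length R) d (d ^ j) ⟩
      length R * (d * d ^ j)        ∎
      where
      open ≤-Reasoning
      R′ : List C
      R′ = survivors (bestCandidate R) R
      u : ℕ
      u = length (uncovered j R′)

-- Enumerating subsets

subsets : ∀ n → List (Subset n)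
subsets zero = [] ∷ []
subsets (suc n) = map (inside ∷_) (subsets n) ++ map (outside ∷_) (subsets n)

subsetsOfSize : ∀ n → ℕ → List (Subset n)
subsetsOfSize zero zero = [] ∷ []
subsetsOfSize zero (suc k) = []
subsetsOfSize (suc n) zero = map (outside ∷_) (subsetsOfSize n zero)
subsetsOfSize (suc n) (suc k) =
  map (inside ∷_) (subsetsOfSize n k) ++ map (outside ∷_) (subsetsOfSize n (suc k))

length-subsets : ∀ n → length (subsets n) ≡ 2 ^ n
length-subsets zero = refl
length-subsets (suc n) = begin
  length (subsets (suc n))                 ≡⟨ length-++-map (inside ∷_) (outside ∷_) (subsets n) (subsets n) ⟩
  length (subsets n) + length (subsets n)  ≡⟨ cong (λ m → m + m) (length-subsets n) ⟩
  2 ^ n + 2 ^ n                            ≡⟨ cong (2 ^ n +_) (+-identityʳ (2 ^ n)) ⟨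
  2 ^ suc n                                ∎
  where open ≡-Reasoning

∈-subsets : ∀ {n} (S : Subset n) → S ∈ subsets n
∈-subsets [] = here refl
∈-subsets (inside ∷ S) = ∈-++⁺ˡ (∈-map⁺ (inside ∷_) (∈-subsets S))
∈-subsets {suc n} (outside ∷ S) = ∈-++⁺ʳ (map (inside ∷_) (subsets n)) (∈-map⁺ (outside ∷_) (∈-subsets S))

length-subsetsOfSize : ∀ n k → length (subsetsOfSize n k) ≡ n C k
length-subsetsOfSize zero zero = refl
length-subsetsOfSize zero (suc k) = refl
length-subsetsOfSize (suc n) zero =
  trans (length-map (outside ∷_) (subsetsOfSize n zero)) (length-subsetsOfSize n zero)
length-subsetsOfSize (suc n) (suc k) = begin
  length (subsetsOfSize (suc n) (suc k))  ≡⟨ length-++-map (inside ∷_) (outside ∷_) (subsetsOfSize n k) _ ⟩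
  length (subsetsOfSize n k) + length (subsetsOfSize n (suc k))
    ≡⟨ cong₂ _+_ (length-subsetsOfSize n k) (length-subsetsOfSize n (suc k)) ⟩
  n C k + n C suc k                       ≡⟨ nCk+nC[k+1]≡[n+1]C[k+1] n k ⟩
  suc n C suc k                           ∎
  where open ≡-Reasoning

subsetsOfSize-sized : ∀ n k → All (λ S → ∣ S ∣ ≡ k) (subsetsOfSize n k)
subsetsOfSize-sized zero zero = refl ∷ []
subsetsOfSize-sized zero (suc k) = []
subsetsOfSize-sized (suc n) zero = All-map⁺ (subsetsOfSize-sized n zero)
subsetsOfSize-sized (suc n) (suc k) =
  All-++⁺ (All-map⁺ (All.map (cong suc) (subsetsOfSize-sized n k))) (All-map⁺ (subsetsOfSize-sized n (suc k)))

count-⊆-subsetsOfSize : ∀ n k (X : Subset n) → count (λ S → does (S ⊆? X)) (subsetsOfSize n k) ≡ ∣ X ∣ C k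
count-⊆-subsetsOfSize zero zero [] = refl
count-⊆-subsetsOfSize zero (suc k) [] = refl
count-⊆-subsetsOfSize (suc n) zero (x ∷ X) =
  trans (count-map _ (outside ∷_) (subsetsOfSize n zero)) (count-⊆-subsetsOfSize n zero X)
count-⊆-subsetsOfSize (suc n) (suc k) (inside ∷ X) = begin
  count (λ S → does (S ⊆? inside ∷ X)) (subsetsOfSize (suc n) (suc k))
    ≡⟨ count-++-map _ (inside ∷_) (outside ∷_) (subsetsOfSize n k) _ ⟩
  count (λ S → does (S ⊆? X)) (subsetsOfSize n k) + count (λ S → does (S ⊆? X)) (subsetsOfSize n (suc k))
    ≡⟨ cong₂ _+_ (count-⊆-subsetsOfSize n k X) (count-⊆-subsetsOfSize n (suc k) X) ⟩
  ∣ X ∣ C k + ∣ X ∣ C suc k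
    ≡⟨ nCk+nC[k+1]≡[n+1]C[k+1] ∣ X ∣ k ⟩
  suc ∣ X ∣ C suc k ∎
  where open ≡-Reasoning
count-⊆-subsetsOfSize (suc n) (suc k) (outside ∷ X) = begin
  count (λ S → does (S ⊆? outside ∷ X)) (subsetsOfSize (suc n) (suc k))
    ≡⟨ count-++-map _ (inside ∷_) (outside ∷_) (subsetsOfSize n k) _ ⟩
  sum (map (λ _ → 0) (subsetsOfSize n k)) + count (λ S → does (S ⊆? X)) (subsetsOfSize n (suc k))
    ≡⟨ cong₂ _+_ (sum-map-zero (subsetsOfSize n k)) (count-⊆-subsetsOfSize n (suc k) X) ⟩
  ∣ X ∣ C suc k ∎
  where open ≡-Reasoning

someSubsetOfSize : ∀ {k n} → k ≤ n → ∃ λ (S : Subset n) → ∣ S ∣ ≡ k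
someSubsetOfSize {n = n} z≤n = ∅ , ∣⊥∣≡0 n
someSubsetOfSize (s≤s k≤n) = let S , ∣S∣≡k = someSubsetOfSize k≤n in inside ∷ S , cong suc ∣S∣≡k

-- A colouring is encoded by its set c of vertices coloured true.
monochromaticᵇ : ∀ {n} → Subset n → Subset n → Bool
monochromaticᵇ S c = does (S ⊆? c) ∨ does (S ⊆? ∁ c)

⊆⇒monochromaticᵇ : ∀ {n} (c S : Subset n) → does (S ⊆? c) ≡ true → monochromaticᵇ S c ≡ true
⊆⇒monochromaticᵇ c S S⊆c = cong (_∨ does (S ⊆? ∁ c)) S⊆c

⊆∁⇒monochromaticᵇ : ∀ {n} (c S : Subset n) → does (S ⊆? ∁ c) ≡ true → monochromaticᵇ S c ≡ true
⊆∁⇒monochromaticᵇ c S S⊆∁c = trans (cong (does (S ⊆? c) ∨_) S⊆∁c) (∨-zeroʳ _)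

largeColourClass : ∀ h (c : Subset (h + h)) → h ≤ ∣ c ∣ ⊎ h ≤ ∣ ∁ c ∣
largeColourClass h c with h ≤? ∣ c ∣
... | yes h≤∣c∣ = inj₁ h≤∣c∣
... | no h≰∣c∣ = inj₂ (begin
  h                 ≡⟨ m+n∸n≡m h h ⟨
  h + h ∸ h         ≤⟨ ∸-monoʳ-≤ (h + h) (<⇒≤ (≰⇒> h≰∣c∣)) ⟩
  h + h ∸ ∣ c ∣     ≡⟨ ∣∁p∣≡n∸∣p∣ c ⟨
  ∣ ∁ c ∣           ∎)
  where open ≤-Reasoning

∣X∣Ck≤count : ∀ {n} k (X : Subset n) {p : Subset n → Bool} → (∀ S → does (S ⊆? X) ≡ true → p S ≡ true) →
              ∣ X ∣ C k ≤ count p (subsetsOfSize n k)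
∣X∣Ck≤count {n} k X ⊆X⇒p =
  ≤-trans (≤-reflexive (sym (count-⊆-subsetsOfSize n k X))) (count-mono ⊆X⇒p (subsetsOfSize n k))

manyMonochromatic : ∀ h k (c : Subset (h + h)) →
                    h C k ≤ count (λ S → monochromaticᵇ S c) (subsetsOfSize (h + h) k)
manyMonochromatic h k c with largeColourClass h c
... | inj₁ h≤∣c∣ = ≤-trans (m≤n⇒mCk≤nCk k h≤∣c∣) (∣X∣Ck≤count k c (⊆⇒monochromaticᵇ c))
... | inj₂ h≤∣∁c∣ = ≤-trans (m≤n⇒mCk≤nCk k h≤∣∁c∣) (∣X∣Ck≤count k (∁ c) (⊆∁⇒monochromaticᵇ c))

monochromaticᵇ-sound : ∀ (H : Hypergraph) (f : Coloring H) S →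
  monochromaticᵇ S (tabulate f) ≡ true → Monochromatic H f S
monochromaticᵇ-sound H f S mono with S ⊆? tabulate f | S ⊆? ∁ (tabulate f)
... | yes S⊆c | _ = true , λ v v∈S → trans (sym (lookup∘tabulate f v)) ([]=⇒lookup (S⊆c v∈S))
... | no _ | yes S⊆∁c = false , λ v v∈S → not-injective (begin
  not (f v)                    ≡⟨ cong not (lookup∘tabulate f v) ⟨
  not (lookup (tabulate f) v)  ≡⟨ lookup-map v not (tabulate f) ⟨
  lookup (∁ (tabulate f)) v    ≡⟨ []=⇒lookup (S⊆∁c v∈S) ⟩
  true                         ∎)
  where open ≡-Reasoning
monochromaticᵇ-sound H f S () | no _ | no _

-- The construction

2^[1+n]*d^J≤[1+d]^J : ∀ d n → 2 ^ suc n * d ^ (suc d * suc n) ≤ suc d ^ (suc d * suc n)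
2^[1+n]*d^J≤[1+d]^J d n = begin
  2 ^ suc n * d ^ (suc d * suc n)      ≡⟨ cong (2 ^ suc n *_) (^-*-assoc d (suc d) (suc n)) ⟨
  2 ^ suc n * (d ^ suc d) ^ suc n      ≡⟨ ^-distribʳ-* 2 (d ^ suc d) (suc n) ⟨
  (2 * d ^ suc d) ^ suc n              ≤⟨ ^-monoˡ-≤ (suc n) (2*x^[1+x]≤[1+x]^[1+x] d) ⟩
  (suc d ^ suc d) ^ suc n              ≡⟨ ^-*-assoc (suc d) (suc d) (suc n) ⟩
  suc d ^ (suc d * suc n)              ∎
  where open ≤-Reasoning

L*[1+d]^J≤2^n*d^J⇒L≡0 : ∀ d n L → L * suc d ^ (suc d * suc n) ≤ 2 ^ n * d ^ (suc d * suc n) → L ≡ 0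
L*[1+d]^J≤2^n*d^J⇒L≡0 d n L L*N≤ = n<1⇒n≡0 (*-cancelˡ-< 2 L 1 (*-cancelʳ-< N (2 * L) 2 (begin-strict
  2 * L * N                ≡⟨ *-assoc 2 L N ⟩
  2 * (L * N)              ≤⟨ *-monoʳ-≤ 2 L*N≤ ⟩
  2 * (2 ^ n * d ^ J)      ≡⟨ *-assoc 2 (2 ^ n) (d ^ J) ⟨
  2 ^ suc n * d ^ J        ≤⟨ 2^[1+n]*d^J≤[1+d]^J d n ⟩
  N                        <⟨ m<m+n N (m^n>0 (suc d) J) ⟩
  N + N                    ≡⟨ cong (N +_) (+-identityʳ N) ⟨
  2 * N                    ∎)))
  where
  open ≤-Reasoning
  J N : ℕ
  J = suc d * suc n
  N = suc d ^ J

greedyHypergraph : ∀ d h k → k ≤ h → (h + h) C k ≤ suc d * (h C k) →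
  ∃ λ (H : Hypergraph) → Uniform k H × ¬ TwoColorable H × numEdges H ≡ suc d * suc (h + h)
greedyHypergraph d h k k≤h ratio = H , uniform , notTwoColorable , G.length-greedyEdges rounds (subsets n)
  where
  n rounds : ℕ
  n = h + h
  rounds = suc d * suc n
  e₀ : ∃ λ (S : Subset n) → ∣ S ∣ ≡ k
  e₀ = someSubsetOfSize (≤-trans k≤h (m≤m+n h h))
  module G = Greedy monochromaticᵇ (subsetsOfSize n k) (proj₁ e₀)
  H : Hypergraph
  H = mkHypergraph n (G.greedyEdges rounds (subsets n))
  instance _ = >-nonZero (nCk>0 k≤h)
  uniform : Uniform k H
  uniform = All.map (All.lookup (proj₂ e₀ ∷ subsetsOfSize-sized n k))
                    (G.greedyEdges⊆candidates rounds (subsets n))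
  fewCandidates : length (subsetsOfSize n k) ≤ suc d * (h C k)
  fewCandidates = subst (_≤ suc d * (h C k)) (sym (length-subsetsOfSize n k)) ratio
  fewUncovered : length (G.uncovered rounds (subsets n)) * suc d ^ rounds ≤ 2 ^ n * d ^ rounds
  fewUncovered = subst (λ L → length (G.uncovered rounds (subsets n)) * suc d ^ rounds ≤ L * d ^ rounds)
    (length-subsets n) (G.length-uncovered d (h C k) (manyMonochromatic h k) fewCandidates rounds (subsets n))
  allCovered : length (G.uncovered rounds (subsets n)) ≡ 0
  allCovered = L*[1+d]^J≤2^n*d^J⇒L≡0 d n _ fewUncovered
  notTwoColorable : ¬ TwoColorable H
  notTwoColorable (f , noneMonochromatic) with G.greedyEdges-cover rounds (subsets n) (∈-subsets (tabulate f))
  ... | inj₁ hit = All¬⇒¬Any noneMonochromatic (Any.map (monochromaticᵇ-sound H f _) hit)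
  ... | inj₂ c∈uncovered = ¬Fin0 (subst Fin allCovered (index c∈uncovered))

uniformNonTwoColorable : ∀ k → let h = halfOrder k in
  ∃ λ (H : Hypergraph) → Uniform k H × ¬ TwoColorable H × numEdges H ≡ 2 ^ suc k * suc (h + h)
uniformNonTwoColorable k =
  let H , uniform , notTwoColorable , #E≡ = greedyHypergraph (pred D) h k (k≤halfOrder k) ratio
  in H , uniform , notTwoColorable , trans #E≡ (cong (_* suc (h + h)) (suc-pred D))
  where
  h D : ℕ
  h = halfOrder k
  D = 2 ^ suc k
  instance _ = m^n≢0 2 (suc k)
  ratio : (h + h) C k ≤ suc (pred D) * (h C k)
  ratio = subst (λ D′ → (h + h) C k ≤ D′ * (h C k)) (sym (suc-pred D)) ([h+h]Ck≤2^[1+k]*hCk k)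

-- Edge count

2*[1+2h]≤k^4 : ∀ k → 4 ≤ k → 2 * suc (halfOrder k + halfOrder k) ≤ k ^ 4
2*[1+2h]≤k^4 _ (s≤s (s≤s (s≤s (s≤s {n = t} _)))) = ≤-trans (m≤m+n _ _) (≤-reflexive (expand t))
  where
  expand : ∀ t → 2 * suc ((4 + t) * suc (2 * (4 + t)) + (4 + t) * suc (2 * (4 + t)))
                   + (t * t * t * t + 16 * (t * t * t) + 88 * (t * t) + 188 * t + 110)
                 ≡ (4 + t) * ((4 + t) * ((4 + t) * ((4 + t) * 1)))
  expand = solve-∀

numEdges-bound : ∀ m k → 4 ^ (4 * suc m) ≤ k →
                 (2 ^ suc k * suc (halfOrder k + halfOrder k)) ^ suc m ≤ 2 ^ (k * (m + 2))
numEdges-bound m k K≤k = begin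
  (2 * 2 ^ k * N) ^ q         ≡⟨ cong (_^ q) (xy∙z≈y∙xz 2 (2 ^ k) N) ⟩
  (2 ^ k * (2 * N)) ^ q       ≡⟨ ^-distribʳ-* (2 ^ k) (2 * N) q ⟩
  (2 ^ k) ^ q * (2 * N) ^ q   ≤⟨ *-monoʳ-≤ ((2 ^ k) ^ q) (^-monoˡ-≤ q (2*[1+2h]≤k^4 k 4≤k)) ⟩
  (2 ^ k) ^ q * (k ^ 4) ^ q   ≡⟨ cong₂ _*_ (^-*-assoc 2 k q) (^-*-assoc k 4 q) ⟩
  2 ^ (k * q) * k ^ (4 * q)   ≤⟨ *-monoʳ-≤ (2 ^ (k * q)) (k^p≤2^k (4 * q) k K≤k) ⟩
  2 ^ (k * q) * 2 ^ k         ≡⟨ ^-distribˡ-+-* 2 (k * q) k ⟨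
  2 ^ (k * q + k)             ≡⟨ cong (2 ^_) (exponent k m) ⟩
  2 ^ (k * (m + 2))           ∎
  where
  open ≤-Reasoning
  q N : ℕ
  q = suc m
  N = suc (halfOrder k + halfOrder k)
  4≤k : 4 ≤ k
  4≤k = ≤-trans (^-monoʳ-≤ 4 {1} {4 * q} (s≤s z≤n)) K≤k
  exponent : ∀ k m → k * suc m + k ≡ k * (m + 2)
  exponent = solve-∀

corollary1p3 : (m : ℕ) → ∃ λ (K : ℕ) → (k : ℕ) → 1 ≤ k → K ≤ k →
    ∃ λ (H : Hypergraph) → Uniform k H × ¬ TwoColorable H ×
      numEdges H ^ suc m ≤ 2 ^ (k * (m + 2))
corollary1p3 m = 4 ^ (4 * suc m) , λ k _ K≤k →
  let H , uniform , notTwoColorable , #E≡ = uniformNonTwoColorable k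
  in H , uniform , notTwoColorable ,
     subst (λ e → e ^ suc m ≤ 2 ^ (k * (m + 2))) (sym #E≡) (numEdges-bound m k K≤k)
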